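{- Let $(C,\sqsubseteq)$ be a complete lattice, $b^*,b_*\colon C\to C$ monotone maps with $b^*$ left adjoint to $b_*$, $a\colon C\to C$ an up-closure operator and $i,f\in C$. If $a\sqsubseteq\omega_{b_*,f}$ (pointwise), then $a$ is $(i\sqcup b^*,f)$-complete.
   Context: $b^*$ left adjoint to $b_*$: $b^*(x)\sqsubseteq y$ iff $x\sqsubseteq b_*(y)$. An up-closure operator is a monotone $a$ with $x\sqsubseteq a(x)$, $a(a(x))\sqsubseteq a(x)$. A monotone $c\colon C\to C$ is $(b_*,f)$-compatible iff $c(f)\sqsubseteq f$ and $c\circ b_*\sqsubseteq b_*\circ c$; the $f$-companion is $\omega_{b_*,f}=\bigsqcup\{c\mid c \text{ monotone and } (b_*,f)\text{ -compatible}\}$ (pointwise join). $i\sqcup b^*$ is the map $x\mapsto i\sqcup b^*(x)$. An up-closure $a$ is $(g,f)$-complete iff $a(f)\sqsubseteq f$ and ($\mu(a\circ g)\sqsubseteq f$ iff $\mu g\sqsubseteq f$), $\mu$ denoting least fixed point. -}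

module Defs where

open import Level using (Level; _⊔_; suc)
open import Data.Product using (Σ; _×_)
open import Data.Sum using (_⊎_)
open import Relation.Binary.Bundles using (Poset)

record CompleteLattice (c ℓ₁ ℓ₂ : Level) : Set (suc (c ⊔ ℓ₁ ⊔ ℓ₂)) where
  field
    poset : Poset c ℓ₁ ℓ₂
  open Poset poset public
  field
    ⋁        : (Carrier → Set (c ⊔ ℓ₁ ⊔ ℓ₂)) → Carrier
    ⋁-upper  : ∀ (P : Carrier → Set (c ⊔ ℓ₁ ⊔ ℓ₂)) x → P x → x ≤ ⋁ P
    ⋁-least  : ∀ (P : Carrier → Set (c ⊔ ℓ₁ ⊔ ℓ₂)) z →
               (∀ x → P x → x ≤ z) → ⋁ P ≤ z

module CL {c ℓ₁ ℓ₂} (L : CompleteLattice c ℓ₁ ℓ₂) where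
  open CompleteLattice L public
  open import Data.Product using (Σ; _×_) public
  open import Data.Sum using (_⊎_) public

  _⊔L_ : Carrier → Carrier → Carrier
  x ⊔L y = ⋁ (λ z → Level.Lift (c ⊔ ℓ₁ ⊔ ℓ₂) ((z ≈ x) ⊎ (z ≈ y)))

  ⋀ : (Carrier → Set (c ⊔ ℓ₁ ⊔ ℓ₂)) → Carrier
  ⋀ P = ⋁ (λ y → ∀ x → P x → y ≤ x)

  -- least fixed point of a (monotone) map, via Knaster–Tarski:
  -- the meet of all prefixed points
  μ : (Carrier → Carrier) → Carrier
  μ g = ⋀ (λ x → Level.Lift (c ⊔ ℓ₁ ⊔ ℓ₂) (g x ≤ x))

  Monotone : (Carrier → Carrier) → Set (c ⊔ ℓ₂)
  Monotone g = ∀ x y → x ≤ y → g x ≤ g y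

  _⊑ₚ_ : (Carrier → Carrier) → (Carrier → Carrier) → Set (c ⊔ ℓ₂)
  g ⊑ₚ h = ∀ x → g x ≤ h x

  LeftAdjoint : (Carrier → Carrier) → (Carrier → Carrier) → Set (c ⊔ ℓ₂)
  LeftAdjoint l r = ∀ x y → (l x ≤ y → x ≤ r y) × (x ≤ r y → l x ≤ y)

  UpClosure : (Carrier → Carrier) → Set (c ⊔ ℓ₂)
  UpClosure a = Monotone a × (∀ x → x ≤ a x) × (∀ x → a (a x) ≤ a x)

  Compatible : (Carrier → Carrier) → Carrier → (Carrier → Carrier) → Set (c ⊔ ℓ₂)
  Compatible b₊ f g = (g f ≤ f) × (∀ x → g (b₊ x) ≤ b₊ (g x))

  companion : (Carrier → Carrier) → Carrier → (Carrier → Carrier)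
  companion b₊ f x =
    ⋁ (λ y → Σ (Carrier → Carrier) λ g → Monotone g × Compatible b₊ f g × (y ≈ g x))

  Complete : (Carrier → Carrier) → (Carrier → Carrier) → Carrier → Set ℓ₂
  Complete a g f =
    (a f ≤ f) × ((μ (λ x → a (g x)) ≤ f → μ g ≤ f) × (μ g ≤ f → μ (λ x → a (g x)) ≤ f))

module Submission where

-- Write t = ω_{b₊,f} for the companion and g = i ⊔ b⋆.
-- (1) Basic complete-lattice facts: binary joins are least upper bounds,
--     μ h is a lower bound of the prefixed points of h, μ is monotone in
--     h, and μ h is itself a prefixed point when h is monotone.
-- (2) Companion facts (for monotone b₊): t dominates every compatible
--     map, and is itself monotone, compatible, inflationary (id is
--     compatible) and idempotent (t ∘ t is compatible).
-- (3) By the adjunction, x is a prefixed point of g iff i ≤ x and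
--     x ≤ b₊ x; since t is inflationary and compatible, t maps prefixed
--     points of g to prefixed points of g, and (as a ≤ t, t idempotent)
--     even to prefixed points of a ∘ g.
-- The theorem: a f ≤ t f ≤ f; μ g ≤ μ (a ∘ g) because a is inflationary;
-- and μ (a ∘ g) ≤ t (μ g) ≤ t f ≤ f whenever μ g ≤ f.

open import Defs
open import Level using (Level; lift)
open import Data.Product using (_,_; proj₁; proj₂)
open import Data.Sum using (inj₁; inj₂)
open import Function using (id; _∘_)

module Theory {c ℓ₁ ℓ₂ : Level} (L : CompleteLattice c ℓ₁ ℓ₂) where
  open CL L

  x≤x⊔y : ∀ x y → x ≤ x ⊔L y
  x≤x⊔y x y = ⋁-upper _ x (lift (inj₁ Eq.refl))

  y≤x⊔y : ∀ x y → y ≤ x ⊔L y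
  y≤x⊔y x y = ⋁-upper _ y (lift (inj₂ Eq.refl))

  ⊔-least : ∀ {x y w} → x ≤ w → y ≤ w → x ⊔L y ≤ w
  ⊔-least x≤w y≤w = ⋁-least _ _ λ
    { z (lift (inj₁ z≈x)) → trans (reflexive z≈x) x≤w
    ; z (lift (inj₂ z≈y)) → trans (reflexive z≈y) y≤w }

  μ-induction : ∀ h {x} → h x ≤ x → μ h ≤ x
  μ-induction h hx≤x = ⋁-least _ _ λ y lower → lower _ (lift hx≤x)

  μ-greatest : ∀ h {z} → (∀ x → h x ≤ x → z ≤ x) → z ≤ μ h
  μ-greatest h below = ⋁-upper _ _ λ x (lift hx≤x) → below x hx≤x

  -- A larger map has fewer prefixed points, hence a larger μ.
  μ-mono : ∀ {h k} → h ⊑ₚ k → μ h ≤ μ k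
  μ-mono {h} {k} h⊑k =
    μ-greatest k λ x kx≤x → μ-induction h (trans (h⊑k x) kx≤x)

  μ-prefixed : ∀ h → Monotone h → h (μ h) ≤ μ h
  μ-prefixed h mono-h =
    μ-greatest h λ x hx≤x → trans (mono-h _ _ (μ-induction h hx≤x)) hx≤x

  module Companion (b₊ : Carrier → Carrier) (f : Carrier)
                   (mono-b₊ : Monotone b₊) where
    t : Carrier → Carrier
    t = companion b₊ f

    t-dominates : ∀ h → Monotone h → Compatible b₊ f h → h ⊑ₚ t
    t-dominates h mono-h compat-h x = ⋁-upper _ (h x) (h , mono-h , compat-h , Eq.refl)

    t-mono : Monotone t
    t-mono x y x≤y = ⋁-least _ _ λ { z (h , mono-h , compat-h , z≈hx) →
      trans (reflexive z≈hx) (trans (mono-h x y x≤y) (t-dominates h mono-h compat-h y)) }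

    t-below-f : t f ≤ f
    t-below-f = ⋁-least _ _ λ { z (h , _ , (hf≤f , _) , z≈hf) →
      trans (reflexive z≈hf) hf≤f }

    t-commutes : ∀ x → t (b₊ x) ≤ b₊ (t x)
    t-commutes x = ⋁-least _ _ λ { z (h , mono-h , compat-h , z≈hbx) →
      trans (reflexive z≈hbx)
        (trans (proj₂ compat-h x) (mono-b₊ _ _ (t-dominates h mono-h compat-h x))) }

    -- The identity is compatible, so t is inflationary.
    t-inflationary : ∀ x → x ≤ t x
    t-inflationary = t-dominates id (λ _ _ x≤y → x≤y) (refl , λ _ → refl)

    -- t ∘ t is compatible, so t is idempotent.
    t-idempotent : ∀ x → t (t x) ≤ t x
    t-idempotent = t-dominates (t ∘ t)
      (λ x y x≤y → t-mono _ _ (t-mono _ _ x≤y))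
      ( trans (t-mono _ _ t-below-f) t-below-f
      , λ x → trans (t-mono _ _ (t-commutes x)) (t-commutes (t x)) )

    t-preserves-postfixed : ∀ {x} → x ≤ b₊ x → t x ≤ b₊ (t x)
    t-preserves-postfixed x≤b₊x = trans (t-mono _ _ x≤b₊x) (t-commutes _)

  module PrefixedPoints (b⋆ b₊ : Carrier → Carrier) (i : Carrier)
              (mono-b⋆ : Monotone b⋆) (adj : LeftAdjoint b⋆ b₊) where
    g : Carrier → Carrier
    g x = i ⊔L b⋆ x

    g-mono : Monotone g
    g-mono x y x≤y = ⊔-least (x≤x⊔y i (b⋆ y)) (trans (mono-b⋆ x y x≤y) (y≤x⊔y i (b⋆ y)))

    prefixed⇒ : ∀ {x} → g x ≤ x → i ≤ x × x ≤ b₊ x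
    prefixed⇒ {x} gx≤x =
      trans (x≤x⊔y i (b⋆ x)) gx≤x , proj₁ (adj x x) (trans (y≤x⊔y i (b⋆ x)) gx≤x)

    ⇒prefixed : ∀ {x} → i ≤ x → x ≤ b₊ x → g x ≤ x
    ⇒prefixed {x} i≤x x≤b₊x = ⊔-least i≤x (proj₂ (adj x x) x≤b₊x)

theorem9p10 : ∀ {c ℓ₁ ℓ₂ : Level} (L : CompleteLattice c ℓ₁ ℓ₂) →
    let open CL L in
    (b⋆ b₊ a : Carrier → Carrier) (i f : Carrier) →
    Monotone b⋆ → Monotone b₊ → LeftAdjoint b⋆ b₊ →
    UpClosure a →
    a ⊑ₚ companion b₊ f →
    Complete a (λ x → i ⊔L b⋆ x) f
theorem9p10 L b⋆ b₊ a i f mono-b⋆ mono-b₊ adj (_ , a-inflationary , _) a⊑t =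
  trans (a⊑t f) t-below-f , μg≤f-from-μag , μag≤f-from-μg
  where
  open CL L
  open Theory L
  open Companion b₊ f mono-b₊
  open PrefixedPoints b⋆ b₊ i mono-b⋆ adj

  -- a is inflationary, so g ⊑ a ∘ g and thus μ g ≤ μ (a ∘ g).
  μg≤f-from-μag : μ (a ∘ g) ≤ f → μ g ≤ f
  μg≤f-from-μag = trans (μ-mono (a-inflationary ∘ g))

  -- t (μ g) is a prefixed point of g, hence of a ∘ g since a ≤ t and t t ≤ t.
  μag≤f-from-μg : μ g ≤ f → μ (a ∘ g) ≤ f
  μag≤f-from-μg μg≤f = trans (μ-induction (a ∘ g) atm-prefixed)
                             (trans (t-mono _ _ μg≤f) t-below-f)
    where
    m : Carrier
    m = μ g
    tm-prefixed : g (t m) ≤ t m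
    tm-prefixed with prefixed⇒ (μ-prefixed g g-mono)
    ... | i≤m , m≤b₊m =
      ⇒prefixed (trans i≤m (t-inflationary m)) (t-preserves-postfixed m≤b₊m)
    atm-prefixed : a (g (t m)) ≤ t m
    atm-prefixed = trans (a⊑t _) (trans (t-mono _ _ tm-prefixed) (t-idempotent m))
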